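{- Let $\mathbf{o}\in\mathbb{R}^{\Upsilon}$ be an SE objective, and let $\mathbb{F}'\subseteq\mathbb{R}^{\Upsilon}$ be the polyhedron of all $\eta$ satisfying every inequality $\langle\mathbf{o}',\eta\rangle\le u'$ that defines an SE face of $\mathbb{F}$ (i.e., is valid on $\mathbb{F}$ and has an SE objective $\mathbf{o}'$). Then the optimal value of maximizing $\eta\mapsto\langle\mathbf{o},\eta\rangle$ over $\mathbb{F}'$ equals the optimal value of maximizing it over $\mathbb{F}$.
   Context: Let $N$ be a finite set with $n=|N|\ge 2$, and let $\mathrm{DAG}(N)$ be the set of acyclic directed graphs with node set $N$; $\mathrm{pa}_G(a)$ is the set of parents of $a$ in $G$. $G\sim H$ (Markov equivalence) means same adjacencies and same immoralities (induced subgraphs $a\to c\leftarrow b$ with $a,b$ non-adjacent). Let $\Upsilon=\{(a|B): a\in N,\ \emptyset\neq B\subseteq N\setminus\{a\}\}$; for $G\in\mathrm{DAG}(N)$, $\eta_G\in\mathbb{R}^{\Upsilon}$ has $\eta_G(a|B)=1$ if $B=\mathrm{pa}_G(a)$ and $0$ otherwise; $\mathbb{F}=\mathrm{conv}\{\eta_G:G\in\mathrm{DAG}(N)\}$; $\langle\mathbf{o},\eta\rangle=\sum_{(a|B)\in\Upsilon}\mathbf{o}(a|B)\eta(a|B)$. An SE objective is $\mathbf{o}\in\mathbb{R}^{\Upsilon}$ with $\langle\mathbf{o},\eta_G\rangle=\langle\mathbf{o},\eta_H\rangle$ whenever $G\sim H$. An SE face of $\mathbb{F}$ is a set $\{\eta\in\mathbb{F}:\langle\mathbf{o}',\eta\rangle=u'\}$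 where $\langle\mathbf{o}',\eta\rangle\le u'$ is valid on $\mathbb{F}$ and $\mathbf{o}'$ is an SE objective. -}

module Defs where

open import Data.Nat using (ℕ; zero; suc)
open import Data.Fin using (Fin)
open import Data.Fin.Subset using (Subset; Side; inside; outside; _∈_; _∉_; Nonempty)
open import Data.Fin.Subset.Properties using (_∈?_; nonempty?)
open import Data.Vec using (Vec; []; _∷_; tabulate)
open import Data.List using (List; []; _∷_; [_]; map; _++_; concatMap; mapMaybe; allFin; foldr)
open import Data.Maybe using (Maybe; just; nothing)
open import Data.Bool using (Bool; true; false)
import Data.Bool as Bool
open import Data.Vec.Properties using (≡-dec)
open import Data.List.Relation.Unary.All using (All)
open import Data.Product using (Σ; ∃; _×_; _,_; proj₁; proj₂)
open import Data.Sum using (_⊎_)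
open import Data.Empty using (⊥)
open import Relation.Nullary using (¬_; yes; no)
open import Relation.Binary.PropositionalEquality using (_≡_; _≢_)
open import Relation.Binary.Construct.Closure.Transitive using (TransClosure)
open import Function.Bundles using (_⇔_)
open import Algebra.Structures using (IsCommutativeRing)
open import Relation.Binary.Structures using (IsTotalOrder)

-- Ordered fields (stand-in for ℝ; ℝ is an instance).  Equality is _≡_.

record OrderedField : Set₁ where
  infixl 6 _+_
  infixl 7 _*_
  infix 4 _≤_
  field
    Carrier : Set
    _+_ _*_ : Carrier → Carrier → Carrier
    -_ : Carrier → Carrier
    0# 1# : Carrier
    _≤_ : Carrier → Carrier → Set
    isCommutativeRing : IsCommutativeRing _≡_ _+_ _*_ -_ 0# 1#
    isTotalOrder : IsTotalOrder _≡_ _≤_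
    0≢1 : 0# ≢ 1#
    inverse : ∀ x → x ≢ 0# → ∃ λ y → x * y ≡ 1#
    +-mono-≤ : ∀ x y z → x ≤ y → x + z ≤ y + z
    *-nonneg : ∀ x y → 0# ≤ x → 0# ≤ y → 0# ≤ x * y

Graph : ℕ → Set
Graph n = Fin n → Fin n → Bool

Edge : ∀ {n} → Graph n → Fin n → Fin n → Set
Edge G a b = G a b ≡ true

Acyclic : ∀ {n} → Graph n → Set
Acyclic G = ∀ a → ¬ TransClosure (Edge G) a a

DAG : ℕ → Set
DAG n = Σ (Graph n) Acyclic

pa : ∀ {n} → DAG n → Fin n → Subset n
pa (G , _) b = tabulate (λ a → G a b)   -- Side is Bool, inside = true

Adjacent : ∀ {n} → DAG n → Fin n → Fin n → Set
Adjacent (G , _) a b = Edge G a b ⊎ Edge G b a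

Immorality : ∀ {n} → DAG n → Fin n → Fin n → Fin n → Set
Immorality D@(G , _) a c b =
  Edge G a c × Edge G b c × a ≢ b × ¬ Adjacent D a b

MarkovEquiv : ∀ {n} → DAG n → DAG n → Set
MarkovEquiv G H =
  (∀ a b → Adjacent G a b ⇔ Adjacent H a b) ×
  (∀ a c b → Immorality G a c b ⇔ Immorality H a c b)

record Υ (n : ℕ) : Set where
  constructor ⟨_∣_,_,_⟩
  field
    node : Fin n
    set  : Subset n
    node∉set : node ∉ set
    nonempty : Nonempty set

allSubsets : ∀ n → List (Subset n)
allSubsets zero    = [ [] ]
allSubsets (suc n) =
  map (inside ∷_) (allSubsets n) ++ map (outside ∷_) (allSubsets n)

mkΥ : ∀ {n} → Fin n → Subset n → Maybe (Υ n)
mkΥ a B with a ∈? B | nonempty? B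
... | no a∉B | yes ne = just ⟨ a ∣ B , a∉B , ne ⟩
... | _      | _      = nothing

-- enumeration of Υ, each element listed exactly once
enumΥ : ∀ n → List (Υ n)
enumΥ n = concatMap (λ a → mapMaybe (mkΥ a) (allSubsets n)) (allFin n)

module _ (K : OrderedField) where
  open OrderedField K

  Vecᵤ : ℕ → Set
  Vecᵤ n = Υ n → Carrier

  ⟪_,_⟫ : ∀ {n} → Vecᵤ n → Vecᵤ n → Carrier
  ⟪_,_⟫ {n} o η = foldr (λ u acc → o u * η u + acc) 0# (enumΥ n)

  ηG : ∀ {n} → DAG n → Vecᵤ n
  ηG G u with ≡-dec Bool._≟_ (Υ.set u) (pa G (Υ.node u))
  ... | yes _ = 1#
  ... | no  _ = 0#

  -- 𝔽 = conv { η_G : G ∈ DAG(N) }: ξ is a convex combination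
  -- Σ λᵢ η_{Gᵢ} with λᵢ ≥ 0 and Σ λᵢ = 1 (finitely many terms).
  In𝔽 : ∀ {n} → Vecᵤ n → Set
  In𝔽 {n} ξ = Σ (List (Carrier × DAG n)) λ cs →
      All (λ c → 0# ≤ proj₁ c) cs
    × foldr (λ c acc → proj₁ c + acc) 0# cs ≡ 1#
    × (∀ u → ξ u ≡ foldr (λ c acc → proj₁ c * ηG (proj₂ c) u + acc) 0# cs)

  SEObjective : ∀ {n} → Vecᵤ n → Set
  SEObjective {n} o = ∀ (G H : DAG n) → MarkovEquiv G H → ⟪ o , ηG G ⟫ ≡ ⟪ o , ηG H ⟫

  ValidOn𝔽 : ∀ {n} → Vecᵤ n → Carrier → Set
  ValidOn𝔽 o u = ∀ ξ → In𝔽 ξ → ⟪ o , ξ ⟫ ≤ u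

  In𝔽' : ∀ {n} → Vecᵤ n → Set
  In𝔽' {n} ξ = ∀ (o' : Vecᵤ n) (u' : Carrier) →
    SEObjective o' → ValidOn𝔽 o' u' → ⟪ o' , ξ ⟫ ≤ u'

  IsMaxValue : ∀ {n} → (Vecᵤ n → Set) → Vecᵤ n → Carrier → Set
  IsMaxValue P o v =
    (∃ λ ξ → P ξ × ⟪ o , ξ ⟫ ≡ v) × (∀ ξ → P ξ → ⟪ o , ξ ⟫ ≤ v)

module Submission where

open import Defs
open import Data.Nat using (ℕ; _≤_)
open import Data.Product using (∃; _×_)

open import Data.Bool using (true; false)
import Data.Bool as Bool
open import Data.Fin as Fin using (Fin; toℕ)
open import Data.Fin.Properties using (any?; all?; pigeonhole)
open import Data.Fin.Subset using (Subset; ⁅_⁆; _∪_; _∈_; Nonempty)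
open import Data.Fin.Subset.Properties
  using (_∈?_; nonempty?; anySubset?; x∈⁅x⁆; x∈⁅y⁆⇒x≡y; x∈p∪q⁺; x∈p∪q⁻)
open import Data.List using (List; []; _∷_; map; cartesianProductWith; mapMaybe; foldr)
import Data.List.Membership.Propositional as List
open import Data.List.Membership.Propositional.Properties
  using (∈-cartesianProductWith⁺; ∈-map⁺; ∈-++⁺ˡ; ∈-++⁺ʳ)
open import Data.List.Relation.Unary.All as All using (All; []; _∷_)
open import Data.List.Relation.Unary.Any using (here)
import Data.List.Relation.Unary.Any.Properties as Any
import Data.Maybe.Relation.Unary.Any as MaybeAny
open import Data.Maybe using (Maybe; just; nothing)
import Data.Nat as ℕ
import Data.Nat.Properties as ℕ
open import Data.Product using (_,_; proj₁; proj₂)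
open import Data.Sum using (_⊎_; inj₁; inj₂)
open import Data.Vec using (Vec; []; _∷_; lookup; tabulate)
open import Data.Vec.Properties using (lookup∘tabulate; tabulate-cong; ≡-dec)
open import Relation.Nullary using (Dec; yes; no; contradiction)
open import Relation.Nullary.Decidable using (_×-dec_; _→-dec_)
open import Relation.Binary.Bundles using (TotalOrder)
open import Relation.Binary.PropositionalEquality
  using (_≡_; refl; sym; trans; cong; cong₂; subst)
open import Relation.Binary.Construct.Closure.Transitive using (TransClosure; [_]; _∷_)
open import Algebra.Bundles using (CommutativeRing)
open import Level using (0ℓ)
import Algebra.Properties.Ring as RingProperties
import Algebra.Properties.Group as GroupProperties
open import Tactic.RingSolver using (solve-∀)
open import Tactic.RingSolver.Core.AlmostCommutativeRing
  using (AlmostCommutativeRing; fromCommutativeRing)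

-- Both maxima equal the largest score ⟪ o , η_G* ⟫ over the finitely many DAGs:
-- by linearity a convex combination of the η_G never scores more than its best
-- vertex. Since 𝔽 ⊆ 𝔽', this value is attained on 𝔽' too, and it bounds 𝔽'
-- because ⟪ o , η ⟫ ≤ ⟪ o , η_G* ⟫ is itself one of the inequalities cutting
-- out 𝔽' (o being an SE objective).

private
  variable
    n : ℕ

_≐_ : Graph n → Graph n → Set
G ≐ H = ∀ a b → G a b ≡ H a b

transClosure-resp-≐ : ∀ {G H : Graph n} → G ≐ H →
  ∀ {x y} → TransClosure (Edge G) x y → TransClosure (Edge H) x y
transClosure-resp-≐ G≐H {x} {y} [ e ]            = [ trans (sym (G≐H x y)) e ]
transClosure-resp-≐ G≐H {x} (_∷_ {y = z} e walk) =
  trans (sym (G≐H x z)) e ∷ transClosure-resp-≐ G≐H walk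

acyclic-resp-≐ : ∀ {G H : Graph n} → G ≐ H → Acyclic G → Acyclic H
acyclic-resp-≐ G≐H acyclic a cycle =
  acyclic a (transClosure-resp-≐ (λ x y → sym (G≐H x y)) cycle)

pa-resp-≐ : ∀ {D D′ : DAG n} → proj₁ D ≐ proj₁ D′ → ∀ b → pa D b ≡ pa D′ b
pa-resp-≐ D≐D′ b = tabulate-cong (λ a → D≐D′ a b)

emptyDAG : DAG n
emptyDAG = (λ _ _ → false) , λ { a [ () ] ; a (() ∷ _) }

module _ (G : Graph n) where

  HasParentsWithin : Subset n → Set
  HasParentsWithin S = Nonempty S × (∀ v → v ∈ S → ∃ λ u → u ∈ S × Edge G u v)

  hasParentsWithin? : ∀ S → Dec (HasParentsWithin S)
  hasParentsWithin? S = nonempty? S ×-dec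
    all? (λ v → v ∈? S →-dec any? (λ u → u ∈? S ×-dec (G u v Bool.≟ true)))

  -- Walking backwards along parents inside S, some vertex repeats after n steps.
  hasParentsWithin⇒cycle : ∀ {S} → HasParentsWithin S → ∃ λ a → TransClosure (Edge G) a a
  hasParentsWithin⇒cycle {S} ((v₀ , v₀∈S) , parent) =
    let i , j , i<j , gᵢ≡gⱼ = pigeonhole ℕ.≤-refl (λ (k : Fin (ℕ.suc n)) → g (toℕ k))
        d , i+1+d≡j       = ℕ.m≤n⇒∃[o]m+o≡n i<j
        jumpsToI          = trans (cong ℕ.suc (ℕ.+-comm d (toℕ i))) i+1+d≡j
    in g (toℕ j) , subst (TransClosure (Edge G) (g (toℕ j))) gᵢ≡gⱼ
                     (subst (λ k → TransClosure (Edge G) (g k) (g (toℕ i))) jumpsToI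
                        (backwards (toℕ i) d))
    where
    ancestor : ℕ → ∃ λ v → v ∈ S
    ancestor ℕ.zero    = v₀ , v₀∈S
    ancestor (ℕ.suc k) = let v , v∈S = ancestor k ; u , u∈S , _ = parent v v∈S in u , u∈S

    g : ℕ → Fin n
    g k = proj₁ (ancestor k)

    parentEdge : ∀ k → Edge G (g (ℕ.suc k)) (g k)
    parentEdge k = proj₂ (proj₂ (parent (g k) (proj₂ (ancestor k))))

    backwards : ∀ i d → TransClosure (Edge G) (g (ℕ.suc d ℕ.+ i)) (g i)
    backwards i ℕ.zero    = [ parentEdge i ]
    backwards i (ℕ.suc d) = parentEdge (ℕ.suc d ℕ.+ i) ∷ backwards i d

  targets : ∀ {x y} → TransClosure (Edge G) x y → Subset n
  targets {y = y} [ _ ]          = ⁅ y ⁆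
  targets (_∷_ {y = z} _ walk) = ⁅ z ⁆ ∪ targets walk

  target∈targets : ∀ {x y} (walk : TransClosure (Edge G) x y) → y ∈ targets walk
  target∈targets [ _ ]                = x∈⁅x⁆ _
  target∈targets (_∷_ {y = z} _ walk) = x∈p∪q⁺ (inj₂ (target∈targets walk))

  targets-haveParents : ∀ {x y} (walk : TransClosure (Edge G) x y) →
    ∀ v → v ∈ targets walk → ∃ λ u → (u ≡ x ⊎ u ∈ targets walk) × Edge G u v
  targets-haveParents {x} [ e ] v v∈ with refl ← x∈⁅y⁆⇒x≡y _ v∈ = x , inj₁ refl , e
  targets-haveParents {x} (_∷_ {y = z} e walk) v v∈ with x∈p∪q⁻ ⁅ z ⁆ (targets walk) v∈
  ... | inj₁ v∈⁅z⁆ with refl ← x∈⁅y⁆⇒x≡y _ v∈⁅z⁆ = x , inj₁ refl , e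
  ... | inj₂ v∈walk with targets-haveParents walk v v∈walk
  ...   | u , inj₁ refl  , e′ = z , inj₂ (x∈p∪q⁺ (inj₁ (x∈⁅x⁆ z))) , e′
  ...   | u , inj₂ u∈walk , e′ = u , inj₂ (x∈p∪q⁺ (inj₂ u∈walk)) , e′

  cycle⇒hasParentsWithin : ∀ {a} → TransClosure (Edge G) a a → ∃ HasParentsWithin
  cycle⇒hasParentsWithin {a} cycle = targets cycle , (a , target∈targets cycle) , parentWithin
    where
    parentWithin : ∀ v → v ∈ targets cycle → ∃ λ u → u ∈ targets cycle × Edge G u v
    parentWithin v v∈ with targets-haveParents cycle v v∈
    ... | u , inj₁ refl , e = u , target∈targets cycle , e
    ... | u , inj₂ u∈   , e = u , u∈ , e

  acyclic? : Dec (Acyclic G)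
  acyclic? with anySubset? hasParentsWithin?
  ... | yes (_ , within) = no λ acyclic → let a , cycle = hasParentsWithin⇒cycle within in acyclic a cycle
  ... | no ¬within       = yes λ a cycle → ¬within (cycle⇒hasParentsWithin cycle)

allVecs : ∀ {A : Set} → List A → ∀ m → List (Vec A m)
allVecs xs ℕ.zero    = [] ∷ []
allVecs xs (ℕ.suc m) = cartesianProductWith _∷_ xs (allVecs xs m)

∈-allVecs : ∀ {A : Set} {xs : List A} {m} (v : Vec A m) →
  (∀ i → lookup v i List.∈ xs) → v List.∈ allVecs xs m
∈-allVecs []      _      = here refl
∈-allVecs (x ∷ v) v⊆xs =
  ∈-cartesianProductWith⁺ _∷_ (v⊆xs Fin.zero) (∈-allVecs v (λ i → v⊆xs (Fin.suc i)))

∈-allSubsets : ∀ (S : Subset n) → S List.∈ allSubsets n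
∈-allSubsets []          = here refl
∈-allSubsets {ℕ.suc n} (true ∷ S)  = ∈-++⁺ˡ (∈-map⁺ (true ∷_) (∈-allSubsets S))
∈-allSubsets {ℕ.suc n} (false ∷ S) =
  ∈-++⁺ʳ (map (true ∷_) (allSubsets n)) (∈-map⁺ (false ∷_) (∈-allSubsets S))

∈-mapMaybe⁺ : ∀ {A B : Set} (f : A → Maybe B) {xs x y} →
  x List.∈ xs → f x ≡ just y → y List.∈ mapMaybe f xs
∈-mapMaybe⁺ f {xs} {y = y} x∈xs fx≡y =
  Any.mapMaybe⁺ f xs (Any.gmap (λ { refl → subst (MaybeAny.Any (y ≡_)) (sym fx≡y) (MaybeAny.just refl) }) x∈xs)

fromMatrix : Vec (Subset n) n → Graph n
fromMatrix M a b = lookup (lookup M a) b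

toMatrix : Graph n → Vec (Subset n) n
toMatrix G = tabulate (λ a → tabulate (G a))

fromMatrix∘toMatrix : ∀ (G : Graph n) → G ≐ fromMatrix (toMatrix G)
fromMatrix∘toMatrix G a b rewrite lookup∘tabulate (λ a → tabulate (G a)) a =
  sym (lookup∘tabulate (G a) b)

dagOf : Vec (Subset n) n → Maybe (DAG n)
dagOf M with acyclic? (fromMatrix M)
... | yes acyclic = just (fromMatrix M , acyclic)
... | no  _       = nothing

dagOf-acyclic : ∀ {M : Vec (Subset n) n} → Acyclic (fromMatrix M) →
  ∃ λ acyclic → dagOf M ≡ just (fromMatrix M , acyclic)
dagOf-acyclic {M = M} acyclic with acyclic? (fromMatrix M)
... | yes acyclic′ = acyclic′ , refl
... | no  cyclic   = contradiction acyclic cyclic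

allDAGs : ∀ n → List (DAG n)
allDAGs n = mapMaybe dagOf (allVecs (allSubsets n) n)

allDAGs-complete : ∀ (D : DAG n) → ∃ λ D′ → D′ List.∈ allDAGs n × proj₁ D ≐ proj₁ D′
allDAGs-complete (G , acyclic) =
  let G≐M = fromMatrix∘toMatrix G
      acyclic′ , dagOf-M = dagOf-acyclic (acyclic-resp-≐ G≐M acyclic)
  in (fromMatrix (toMatrix G) , acyclic′)
   , ∈-mapMaybe⁺ dagOf (∈-allVecs (toMatrix G) (λ _ → ∈-allSubsets _)) dagOf-M
   , G≐M

module _ {c ℓ₁ ℓ₂} (T : TotalOrder c ℓ₁ ℓ₂) where
  open TotalOrder T renaming (_≤_ to _⊑_)
  open import Data.List.Extrema T using (argmax; f[xs]≤f[argmax])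

  maximumOverDAGs : (f : DAG n → Carrier) → (∀ {D D′} → proj₁ D ≐ proj₁ D′ → f D ≈ f D′) →
    ∃ λ D* → ∀ D → f D ⊑ f D*
  maximumOverDAGs {n} f f-resp = argmax f emptyDAG (allDAGs n) , λ D →
    let D′ , D′∈ , D≐D′ = allDAGs-complete D
    in ≤-respˡ-≈ (Eq.sym (f-resp D≐D′)) (All.lookup (f[xs]≤f[argmax] {f = f} emptyDAG (allDAGs n)) D′∈)

module _ (K : OrderedField) where
  commutativeRing : CommutativeRing 0ℓ 0ℓ
  commutativeRing = record { isCommutativeRing = OrderedField.isCommutativeRing K }

  almostCommutativeRing : AlmostCommutativeRing 0ℓ 0ℓ
  almostCommutativeRing = fromCommutativeRing commutativeRing (λ _ → nothing)

  totalOrder : TotalOrder 0ℓ 0ℓ 0ℓ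
  totalOrder = record { isTotalOrder = OrderedField.isTotalOrder K }

  -- Stated with the solver's own operators, which solve-∀ has to recognise in the goal.
  module Identities where
    open AlmostCommutativeRing almostCommutativeRing

    regroup : ∀ p a x y s t → p * (a * x + y) + (a * s + t) ≡ a * (p * x + s) + (p * y + t)
    regroup = solve-∀ almostCommutativeRing

  open OrderedField K renaming (_≤_ to _⊑_)
  open CommutativeRing commutativeRing
    using (+-comm; +-identityˡ; +-identityʳ; *-identityˡ; zeroˡ; zeroʳ; distribˡ; distribʳ; -‿inverseʳ)
  open RingProperties (CommutativeRing.ring commutativeRing) using (-1*x≈-x; -‿involutive)
  open GroupProperties (CommutativeRing.+-group commutativeRing) using (//-rightDividesˡ)
  open TotalOrder totalOrder using (total)
  open import Relation.Binary.Reasoning.PartialOrder (TotalOrder.poset totalOrder)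

  +-mono-⊑ : ∀ {a b c d} → a ⊑ b → c ⊑ d → a + c ⊑ b + d
  +-mono-⊑ {a} {b} {c} {d} a⊑b c⊑d = begin
    a + c  ≤⟨ +-mono-≤ a b c a⊑b ⟩
    b + c  ≡⟨ +-comm b c ⟩
    c + b  ≤⟨ +-mono-≤ c d b c⊑d ⟩
    d + b  ≡⟨ +-comm d b ⟩
    b + d  ∎

  x⊑y⇒0⊑y-x : ∀ {x y} → x ⊑ y → 0# ⊑ y + - x
  x⊑y⇒0⊑y-x {x} {y} x⊑y = begin
    0#      ≡⟨ -‿inverseʳ x ⟨
    x + - x ≤⟨ +-mono-≤ x y (- x) x⊑y ⟩
    y + - x ∎

  0⊑1 : 0# ⊑ 1#
  0⊑1 with total 0# 1#
  ... | inj₁ 0⊑1 = 0⊑1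
  ... | inj₂ 1⊑0 = begin
    0#              ≤⟨ *-nonneg (- 1#) (- 1#) 0⊑-1 0⊑-1 ⟩
    - 1# * - 1#     ≡⟨ -1*x≈-x (- 1#) ⟩
    - - 1#          ≡⟨ -‿involutive 1# ⟩
    1#              ∎
    where
    0⊑-1 : 0# ⊑ - 1#
    0⊑-1 = subst (0# ⊑_) (+-identityˡ (- 1#)) (x⊑y⇒0⊑y-x 1⊑0)

  *-monoʳ-⊑-nonneg : ∀ {l x y} → 0# ⊑ l → x ⊑ y → l * x ⊑ l * y
  *-monoʳ-⊑-nonneg {l} {x} {y} 0⊑l x⊑y = begin
    l * x                    ≡⟨ +-identityˡ (l * x) ⟨
    0# + l * x               ≤⟨ +-mono-≤ 0# _ (l * x) (*-nonneg l _ 0⊑l (x⊑y⇒0⊑y-x x⊑y)) ⟩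
    l * (y + - x) + l * x    ≡⟨ distribˡ l (y + - x) x ⟨
    l * (y + - x + x)        ≡⟨ cong (l *_) (//-rightDividesˡ x y) ⟩
    l * y                    ∎

  ⟪_∣_⟫ : Vecᵤ K n → Vecᵤ K n → Carrier
  ⟪ o ∣ ξ ⟫ = ⟪_,_⟫ K o ξ

  pairing-cong : ∀ (o : Vecᵤ K n) {ξ ζ} → (∀ u → ξ u ≡ ζ u) → ⟪ o ∣ ξ ⟫ ≡ ⟪ o ∣ ζ ⟫
  pairing-cong {n} o {ξ} {ζ} ξ≗ζ = go (enumΥ n)
    where
    go : ∀ us → foldr (λ u acc → o u * ξ u + acc) 0# us ≡ foldr (λ u acc → o u * ζ u + acc) 0# us
    go []       = refl
    go (u ∷ us) = cong₂ (λ a b → o u * a + b) (ξ≗ζ u) (go us)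

  pairing-zero : ∀ (o : Vecᵤ K n) → ⟪ o ∣ (λ _ → 0#) ⟫ ≡ 0#
  pairing-zero {n} o = go (enumΥ n)
    where
    go : ∀ us → foldr (λ u acc → o u * 0# + acc) 0# us ≡ 0#
    go []       = refl
    go (u ∷ us) = trans (cong₂ _+_ (zeroʳ (o u)) (go us)) (+-identityʳ 0#)

  pairing-linear : ∀ (o ξ ζ : Vecᵤ K n) a → ⟪ o ∣ (λ u → a * ξ u + ζ u) ⟫ ≡ a * ⟪ o ∣ ξ ⟫ + ⟪ o ∣ ζ ⟫
  pairing-linear {n} o ξ ζ a = go (enumΥ n)
    where
    go : ∀ us → foldr (λ u acc → o u * (a * ξ u + ζ u) + acc) 0# us
              ≡ a * foldr (λ u acc → o u * ξ u + acc) 0# us + foldr (λ u acc → o u * ζ u + acc) 0# us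
    go []       = sym (trans (+-identityʳ (a * 0#)) (zeroʳ a))
    go (u ∷ us) = trans (cong (o u * (a * ξ u + ζ u) +_) (go us)) (Identities.regroup (o u) a (ξ u) (ζ u) _ _)

  ηG-resp-≐ : ∀ {D D′ : DAG n} → proj₁ D ≐ proj₁ D′ → ∀ u → ηG K D u ≡ ηG K D′ u
  ηG-resp-≐ {D = D} {D′} D≐D′ u
    with ≡-dec Bool._≟_ (Υ.set u) (pa D (Υ.node u)) | ≡-dec Bool._≟_ (Υ.set u) (pa D′ (Υ.node u))
  ... | yes _     | yes _      = refl
  ... | no  _     | no  _      = refl
  ... | yes u≡paD | no  u≢paD′ = contradiction (trans u≡paD (pa-resp-≐ {D = D} {D′} D≐D′ (Υ.node u))) u≢paD′
  ... | no  u≢paD | yes u≡paD′ = contradiction (trans u≡paD′ (sym (pa-resp-≐ {D = D} {D′} D≐D′ (Υ.node u)))) u≢paD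

  optimalDAG : ∀ (o : Vecᵤ K n) → ∃ λ D* → ∀ D → ⟪ o ∣ ηG K D ⟫ ⊑ ⟪ o ∣ ηG K D* ⟫
  optimalDAG o = maximumOverDAGs totalOrder (λ D → ⟪ o ∣ ηG K D ⟫)
                   (λ D≐D′ → pairing-cong o (ηG-resp-≐ D≐D′))

  combination : List (Carrier × DAG n) → Vecᵤ K n
  combination cs u = foldr (λ c acc → proj₁ c * ηG K (proj₂ c) u + acc) 0# cs

  weightSum : List (Carrier × DAG n) → Carrier
  weightSum = foldr (λ c acc → proj₁ c + acc) 0#

  pairing-combination-⊑ : ∀ (o : Vecᵤ K n) {v} → (∀ D → ⟪ o ∣ ηG K D ⟫ ⊑ v) →
    ∀ cs → All (λ c → 0# ⊑ proj₁ c) cs → ⟪ o ∣ combination cs ⟫ ⊑ weightSum cs * v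
  pairing-combination-⊑ o {v} vertex⊑v [] [] = begin
    ⟪ o ∣ combination [] ⟫  ≡⟨ pairing-zero o ⟩
    0#                      ≡⟨ zeroˡ v ⟨
    0# * v                  ∎
  pairing-combination-⊑ o {v} vertex⊑v ((l , D) ∷ cs) (0⊑l ∷ 0⊑cs) = begin
    ⟪ o ∣ combination ((l , D) ∷ cs) ⟫          ≡⟨ pairing-linear o (ηG K D) (combination cs) l ⟩
    l * ⟪ o ∣ ηG K D ⟫ + ⟪ o ∣ combination cs ⟫ ≤⟨ +-mono-⊑ (*-monoʳ-⊑-nonneg 0⊑l (vertex⊑v D))
                                                               (pairing-combination-⊑ o vertex⊑v cs 0⊑cs) ⟩
    l * v + weightSum cs * v                    ≡⟨ distribʳ v l (weightSum cs) ⟨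
    (l + weightSum cs) * v                      ∎

  vertexBound⇒validOn𝔽 : ∀ (o : Vecᵤ K n) {v} → (∀ D → ⟪ o ∣ ηG K D ⟫ ⊑ v) → ValidOn𝔽 K o v
  vertexBound⇒validOn𝔽 o {v} vertex⊑v ξ (cs , 0⊑cs , weights≡1 , ξ≗cs) = begin
    ⟪ o ∣ ξ ⟫                ≡⟨ pairing-cong o ξ≗cs ⟩
    ⟪ o ∣ combination cs ⟫   ≤⟨ pairing-combination-⊑ o vertex⊑v cs 0⊑cs ⟩
    weightSum cs * v         ≡⟨ cong (_* v) weights≡1 ⟩
    1# * v                   ≡⟨ *-identityˡ v ⟩
    v                        ∎

  η∈𝔽 : ∀ (D : DAG n) → In𝔽 K (ηG K D)
  η∈𝔽 D = (1# , D) ∷ [] , 0⊑1 ∷ [] , +-identityʳ 1# ,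
          λ u → sym (trans (+-identityʳ (1# * ηG K D u)) (*-identityˡ (ηG K D u)))

  𝔽⊆𝔽′ : ∀ {ξ : Vecᵤ K n} → In𝔽 K ξ → In𝔽' K ξ
  𝔽⊆𝔽′ ξ∈𝔽 _ _ _ valid = valid _ ξ∈𝔽

lemma12 : (K : OrderedField) (n : ℕ) → 2 ≤ n →
    (o : Vecᵤ K n) → SEObjective K o →
    ∃ λ v → IsMaxValue K (In𝔽' K) o v × IsMaxValue K (In𝔽 K) o v
lemma12 K n _ o o-SE =
  ⟪_,_⟫ K o (ηG K D*)
  , ((ηG K D* , 𝔽⊆𝔽′ K (η∈𝔽 K D*) , refl) , λ ξ ξ∈𝔽′ → ξ∈𝔽′ o _ o-SE valid)
  , ((ηG K D* , η∈𝔽 K D* , refl) , valid)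
  where
  D* : DAG n
  D* = proj₁ (optimalDAG K o)
  valid : ValidOn𝔽 K o (⟪_,_⟫ K o (ηG K D*))
  valid = vertexBound⇒validOn𝔽 K o (proj₂ (optimalDAG K o))
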